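{- Let $n \ge 1$ and let $\mathcal{F}, \mathcal{G} \subseteq 2^{[n]}$ be a pair of intersecting, cross-Sperner set systems. Then $$|\mathcal{F}| + |\mathcal{G}| \le 2^{n-1},$$ and this bound is best possible (there exist such pairs with $|\mathcal{F}|+|\mathcal{G}| = 2^{n-1}$).
   Context: A set system $\mathcal{H}$ is intersecting if $H_1 \cap H_2 \neq \emptyset$ for all $H_1, H_2 \in \mathcal{H}$. Two set systems $\mathcal{F}, \mathcal{G}$ are intersecting, cross-Sperner if both $\mathcal{F}$ and $\mathcal{G}$ are intersecting and there are no $F \in \mathcal{F}$, $G \in \mathcal{G}$ with $F \subseteq G$ or $G \subseteq F$. -}

module Defs where

open import Data.Nat using (ℕ)
open import Data.List using (List)
open import Data.List.Membership.Propositional using (_∈_)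
open import Data.Fin.Subset using (Subset; _⊆_; _∩_; Nonempty)
open import Data.Product using (_×_)
open import Relation.Nullary using (¬_)

-- A set system on [n] is a finite list of subsets of Fin n; it is a genuine
-- set (family) when the list has no duplicates (imposed separately via Unique),
-- and then its cardinality is the list length.

Intersecting : {n : ℕ} → List (Subset n) → Set
Intersecting H = ∀ {A B} → A ∈ H → B ∈ H → Nonempty (A ∩ B)

CrossSperner : {n : ℕ} → List (Subset n) → List (Subset n) → Set
CrossSperner F G = ∀ {A B} → A ∈ F → B ∈ G → ¬ (A ⊆ B) × ¬ (B ⊆ A)

IntersectingCrossSperner : {n : ℕ} → List (Subset n) → List (Subset n) → Set
IntersectingCrossSperner F G = Intersecting F × Intersecting G × CrossSperner F G

-- Replace F and G by their up-closures U and V. Cross-Sperner puts F inside U ∖ V and G inside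
-- V ∖ U, and U, V are intersecting up-sets, so |U|, |V| ≤ N/2 for N = 2ⁿ, while Kleitman's
-- inequality gives |U| |V| ≤ N |U ∩ V|. Writing |U| = c + d and |V| = c + e with c = |U ∩ V|,
-- these three facts force d + e ≤ N/2 (as (N - 2(c+d))(N - 2(c+e)) ≥ 0), whence
-- |F| + |G| ≤ 2ⁿ⁻¹. Equality holds for F = all sets containing a fixed point and G = ∅.
module Submission where

open import Defs
open import Data.Bool as Bool using (Bool; true; false; T; not; _∧_; if_then_else_)
open import Data.Bool.Properties using (∧-comm; T-≡)
open import Data.Empty using (⊥-elim)
open import Data.Fin using (zero)
open import Data.Fin.Subset using (Subset; inside; outside; _⊆_; ∁)
open import Data.Fin.Subset.Properties using (_⊆?_; ⊆-refl; out⊆; s⊆s; x∈p∩q⁻; x∈p⇒x∉∁p)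
open import Data.List using (List; []; _∷_; length; map; _++_)
open import Data.List.Properties using (length-map; length-++)
open import Data.List.Membership.Propositional using (_∈_; find; lose)
open import Data.List.Membership.Propositional.Properties using (∈-map⁻)
open import Data.List.Relation.Unary.All as All using ()
open import Data.List.Relation.Unary.AllPairs using (_∷_; [])
open import Data.List.Relation.Unary.Any using (here; there; any?)
open import Data.List.Relation.Unary.Unique.Propositional using (Unique)
import Data.List.Relation.Unary.Unique.Propositional.Properties as Unique
open import Data.Nat using (ℕ; zero; suc; _+_; _*_; _∸_; _^_; _≤_; _≥_; z≤n; s≤s; NonZero)
open import Data.Nat.Properties hiding (_≟_)
open import Data.Nat.Tactic.RingSolver using (solve-∀)
open import Algebra.Properties.CommutativeSemigroup +-commutativeSemigroup using (interchange)
open import Data.Product using (_×_; _,_; proj₁; proj₂; Σ-syntax)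
open import Data.Vec as Vec using ([]; _∷_)
open import Data.Vec.Properties using (≡-dec)
open import Function using (_∘_; const; Equivalence)
open import Relation.Binary.Definitions using (DecidableEquality)
open import Relation.Binary.PropositionalEquality
open import Relation.Nullary using (¬_; does; yes; no)
open import Relation.Nullary.Decidable using (⌊_⌋; toWitness; fromWitness)

private
  variable
    n : ℕ

_≟_ : DecidableEquality (Subset n)
_≟_ = ≡-dec Bool._≟_

indicator : Bool → ℕ
indicator b = if b then 1 else 0

count : (Subset n → Bool) → ℕ
count {zero}  p = indicator (p [])
count {suc n} p = count (p ∘ (outside ∷_)) + count (p ∘ (inside ∷_))

count-cong : (p q : Subset n → Bool) → (∀ S → p S ≡ q S) → count p ≡ count q
count-cong {zero}  p q p≗q = cong indicator (p≗q [])
count-cong {suc n} p q p≗q =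
  cong₂ _+_ (count-cong _ _ (p≗q ∘ (outside ∷_))) (count-cong _ _ (p≗q ∘ (inside ∷_)))

indicator-mono : ∀ a b → (T a → T b) → indicator a ≤ indicator b
indicator-mono false b       a⇒b = z≤n
indicator-mono true  true    a⇒b = ≤-refl
indicator-mono true  false   a⇒b = ⊥-elim (a⇒b _)

count-mono : (p q : Subset n → Bool) → (∀ S → T (p S) → T (q S)) → count p ≤ count q
count-mono {zero}  p q p⇒q = indicator-mono (p []) (q []) (p⇒q [])
count-mono {suc n} p q p⇒q =
  +-mono-≤ (count-mono _ _ (p⇒q ∘ (outside ∷_))) (count-mono _ _ (p⇒q ∘ (inside ∷_)))

count-false : count {n} (const false) ≡ 0
count-false {zero}  = refl
count-false {suc n} = cong₂ _+_ (count-false {n}) (count-false {n})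

indicator-partition : ∀ a b → indicator a ≡ indicator (b ∧ a) + indicator (not b ∧ a)
indicator-partition false false = refl
indicator-partition false true  = refl
indicator-partition true  false = refl
indicator-partition true  true  = refl

count-partition : (p q : Subset n → Bool) →
  count p ≡ count (λ S → q S ∧ p S) + count (λ S → not (q S) ∧ p S)
count-partition {zero}  p q = indicator-partition (p []) (q [])
count-partition {suc n} p q =
  trans (cong₂ _+_ (count-partition p₀ q₀) (count-partition p₁ q₁))
        (interchange (count (λ S → q₀ S ∧ p₀ S)) (count (λ S → not (q₀ S) ∧ p₀ S))
                     (count (λ S → q₁ S ∧ p₁ S)) (count (λ S → not (q₁ S) ∧ p₁ S)))
  where
  p₀ p₁ q₀ q₁ : Subset n → Bool
  p₀ = p ∘ (outside ∷_)
  p₁ = p ∘ (inside ∷_)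
  q₀ = q ∘ (outside ∷_)
  q₁ = q ∘ (inside ∷_)

indicator-disjoint : ∀ a b → (T a → ¬ T b) → indicator a + indicator b ≤ 1
indicator-disjoint false b     a⇒¬b = indicator-mono b true _
indicator-disjoint true  false a⇒¬b = ≤-refl
indicator-disjoint true  true  a⇒¬b = ⊥-elim (a⇒¬b _ _)

count-disjoint : (p q : Subset n → Bool) → (∀ S → T (p S) → ¬ T (q S)) → count p + count q ≤ 2 ^ n
count-disjoint {zero}  p q p⇒¬q = indicator-disjoint (p []) (q []) (p⇒¬q [])
count-disjoint {suc n} p q p⇒¬q = begin
  (count p₀ + count p₁) + (count q₀ + count q₁) ≡⟨ interchange (count p₀) (count p₁) (count q₀) (count q₁) ⟩
  (count p₀ + count q₀) + (count p₁ + count q₁) ≤⟨ +-mono-≤ (count-disjoint p₀ q₀ (p⇒¬q ∘ (outside ∷_)))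
                                                            (count-disjoint p₁ q₁ (p⇒¬q ∘ (inside ∷_))) ⟩
  2 ^ n + 2 ^ n                                  ≡⟨ cong (2 ^ n +_) (sym (+-identityʳ (2 ^ n))) ⟩
  2 ^ suc n                                      ∎
  where
  open ≤-Reasoning
  p₀ p₁ q₀ q₁ : Subset n → Bool
  p₀ = p ∘ (outside ∷_)
  p₁ = p ∘ (inside ∷_)
  q₀ = q ∘ (outside ∷_)
  q₁ = q ∘ (inside ∷_)

count-∘∁ : (p : Subset n → Bool) → count (p ∘ ∁) ≡ count p
count-∘∁ {zero}  p = refl
count-∘∁ {suc n} p =
  trans (cong₂ _+_ (count-∘∁ (p ∘ (inside ∷_))) (count-∘∁ (p ∘ (outside ∷_))))
        (+-comm (count (p ∘ (inside ∷_))) (count (p ∘ (outside ∷_))))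

count-antipodal : (p : Subset n → Bool) → (∀ S → T (p S) → ¬ T (p (∁ S))) → 2 * count p ≤ 2 ^ n
count-antipodal {n} p antipodal = begin
  2 * count p                 ≡⟨ cong (count p +_) (+-identityʳ (count p)) ⟩
  count p + count p           ≡⟨ cong (count p +_) (sym (count-∘∁ p)) ⟩
  count p + count (p ∘ ∁)     ≤⟨ count-disjoint p (p ∘ ∁) antipodal ⟩
  2 ^ n                       ∎
  where open ≤-Reasoning

count-singleton : (A : Subset n) → count (λ S → does (S ≟ A)) ≡ 1
count-singleton []                   = refl
count-singleton {suc n} (outside ∷ A) = cong₂ _+_ (count-singleton A) (count-false {n})
count-singleton {suc n} (inside  ∷ A) = cong₂ _+_ (count-false {n}) (count-singleton A)

length≤count : (p : Subset n → Bool) {F : List (Subset n)} →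
  Unique F → (∀ {S} → S ∈ F → T (p S)) → length F ≤ count p
length≤count p {[]}    []          F⊆p = z≤n
length≤count p {A ∷ F} (A∉F ∷ F-unique) F⊆p = begin
  suc (length F)                ≤⟨ s≤s (length≤count p∖A F-unique F⊆p∖A) ⟩
  1 + count p∖A                 ≡⟨ cong (_+ count p∖A) (sym (count-singleton A)) ⟩
  count ≡A + count p∖A          ≡⟨ cong (_+ count p∖A) (sym (count-cong _ ≡A ≡A∧p≗≡A)) ⟩
  count (λ S → ≡A S ∧ p S) + count p∖A ≡⟨ sym (count-partition p ≡A) ⟩
  count p                       ∎
  where
  open ≤-Reasoning
  ≡A p∖A : Subset _ → Bool
  ≡A S = does (S ≟ A)
  p∖A S = not (≡A S) ∧ p S
  ≡A∧p≗≡A : ∀ S → ≡A S ∧ p S ≡ ≡A S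
  ≡A∧p≗≡A S with S ≟ A
  ... | yes refl = Equivalence.to T-≡ (F⊆p (here refl))
  ... | no  _    = refl
  F⊆p∖A : ∀ {S} → S ∈ F → T (p∖A S)
  F⊆p∖A {S} S∈F with S ≟ A
  ... | yes refl = ⊥-elim (All.lookup A∉F S∈F refl)
  ... | no  _    = F⊆p (there S∈F)

UpClosed : (Subset n → Bool) → Set
UpClosed p = ∀ {S S′} → S ⊆ S′ → T (p S) → T (p S′)

restrict-upClosed : ∀ s {p : Subset (suc n) → Bool} → UpClosed p → UpClosed (p ∘ (s ∷_))
restrict-upClosed s p↑ S⊆S′ = p↑ (s⊆s S⊆S′)

chebyshev-sum : ∀ {a₀ a₁ b₀ b₁} → a₀ ≤ a₁ → b₀ ≤ b₁ →
  (a₀ + a₁) * (b₀ + b₁) ≤ 2 * (a₀ * b₀ + a₁ * b₁)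
chebyshev-sum {a₀} {_} {b₀} a₀≤a₁ b₀≤b₁ with m≤n⇒∃[o]m+o≡n a₀≤a₁ | m≤n⇒∃[o]m+o≡n b₀≤b₁
... | s , refl | t , refl = m+n≤o⇒m≤o _ (≤-reflexive (identity a₀ b₀ s t))
  where
  identity : ∀ a b s t → (a + (a + s)) * (b + (b + t)) + s * t ≡ 2 * (a * b + (a + s) * (b + t))
  identity = solve-∀

kleitman : (p q : Subset n → Bool) → UpClosed p → UpClosed q →
  count p * count q ≤ 2 ^ n * count (λ S → p S ∧ q S)
kleitman {zero} p q _ _ with p [] | q []
... | true  | true  = ≤-refl
... | true  | false = z≤n
... | false | _     = z≤n
-- Up-closure makes p₀ ⊆ p₁ and q₀ ⊆ q₁, so the halves are similarly ordered and Chebyshev applies.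
kleitman {suc n} p q p↑ q↑ = begin
  (count p₀ + count p₁) * (count q₀ + count q₁)
    ≤⟨ chebyshev-sum (count-mono p₀ p₁ (λ _ → p↑ (out⊆ ⊆-refl))) (count-mono q₀ q₁ (λ _ → q↑ (out⊆ ⊆-refl))) ⟩
  2 * (count p₀ * count q₀ + count p₁ * count q₁)
    ≤⟨ *-monoʳ-≤ 2 (+-mono-≤ (kleitman p₀ q₀ (restrict-upClosed outside p↑) (restrict-upClosed outside q↑))
                             (kleitman p₁ q₁ (restrict-upClosed inside p↑) (restrict-upClosed inside q↑))) ⟩
  2 * (2 ^ n * count pq₀ + 2 ^ n * count pq₁)
    ≡⟨ distrib (2 ^ n) (count pq₀) (count pq₁) ⟩
  2 ^ suc n * (count pq₀ + count pq₁) ∎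
  where
  open ≤-Reasoning
  p₀ p₁ q₀ q₁ pq₀ pq₁ : Subset n → Bool
  p₀ = p ∘ (outside ∷_)
  p₁ = p ∘ (inside ∷_)
  q₀ = q ∘ (outside ∷_)
  q₁ = q ∘ (inside ∷_)
  pq₀ S = p₀ S ∧ q₀ S
  pq₁ S = p₁ S ∧ q₁ S
  distrib : ∀ N x y → 2 * (N * x + N * y) ≡ 2 * N * (x + y)
  distrib = solve-∀

n*[a+b]≤n*n+a*b : ∀ {a b n} → a ≤ n → b ≤ n → n * (a + b) ≤ n * n + a * b
n*[a+b]≤n*n+a*b {a} {b} {n} a≤n b≤n with m≤n⇒∃[o]m+o≡n a≤n | m≤n⇒∃[o]m+o≡n b≤n
... | x , a+x≡n | y , b+y≡n = begin
  n * (a + b)                        ≤⟨ m≤m+n _ (x * y) ⟩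
  n * (a + b) + x * y                ≡⟨ cong (_+ x * y) (*-distribˡ-+ n a b) ⟩
  n * a + n * b + x * y              ≡⟨ cong₂ (λ n₁ n₂ → n₁ * a + n₂ * b + x * y) (sym b+y≡n) (sym a+x≡n) ⟩
  (b + y) * a + (a + x) * b + x * y  ≡⟨ identity a b x y ⟩
  (a + x) * (b + y) + a * b          ≡⟨ cong₂ (λ n₁ n₂ → n₁ * n₂ + a * b) a+x≡n b+y≡n ⟩
  n * n + a * b                      ∎
  where
  open ≤-Reasoning
  identity : ∀ a b x y → (b + y) * a + (a + x) * b + x * y ≡ (a + x) * (b + y) + a * b
  identity = solve-∀

symmetric-difference-bound : ∀ N c d e .{{_ : NonZero N}} →
  2 * (c + d) ≤ N → 2 * (c + e) ≤ N → (c + d) * (c + e) ≤ N * c → 2 * (d + e) ≤ N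
symmetric-difference-bound N c d e 2[c+d]≤N 2[c+e]≤N kleitman-bound =
  +-cancelʳ-≤ (4 * c) (2 * (d + e)) N (subst (_≤ N + 4 * c) (sum≡ c d e) (*-cancelˡ-≤ N (begin
    N * (A + B)                    ≤⟨ n*[a+b]≤n*n+a*b 2[c+d]≤N 2[c+e]≤N ⟩
    N * N + A * B                  ≡⟨ cong (N * N +_) (product≡ c d e) ⟩
    N * N + 4 * ((c + d) * (c + e)) ≤⟨ +-monoʳ-≤ (N * N) (*-monoʳ-≤ 4 kleitman-bound) ⟩
    N * N + 4 * (N * c)            ≡⟨ factor N c ⟩
    N * (N + 4 * c)                ∎)))
  where
  open ≤-Reasoning
  A B : ℕ
  A = 2 * (c + d)
  B = 2 * (c + e)
  sum≡ : ∀ c d e → 2 * (c + d) + 2 * (c + e) ≡ 2 * (d + e) + 4 * c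
  sum≡ = solve-∀
  product≡ : ∀ c d e → 2 * (c + d) * (2 * (c + e)) ≡ 4 * ((c + d) * (c + e))
  product≡ = solve-∀
  factor : ∀ N c → N * N + 4 * (N * c) ≡ N * (N + 4 * c)
  factor = solve-∀

upClosure : List (Subset n) → Subset n → Bool
upClosure F S = ⌊ any? (_⊆? S) F ⌋

upClosure⁺ : (F : List (Subset n)) {A S : Subset n} → A ∈ F → A ⊆ S → T (upClosure F S)
upClosure⁺ F {S = S} A∈F A⊆S = fromWitness (lose {P = _⊆ S} A∈F A⊆S)

upClosure⁻ : (F : List (Subset n)) {S : Subset n} → T (upClosure F S) → Σ[ A ∈ Subset n ] A ∈ F × A ⊆ S
upClosure⁻ F {S} S∈U = find (toWitness {a? = any? (_⊆? S) F} S∈U)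

upClosure-upClosed : (F : List (Subset n)) → UpClosed (upClosure F)
upClosure-upClosed F S⊆S′ S∈U with upClosure⁻ F S∈U
... | A , A∈F , A⊆S = upClosure⁺ F A∈F (λ x∈A → S⊆S′ (A⊆S x∈A))

upClosure-antipodal : (F : List (Subset n)) → Intersecting F →
  ∀ S → T (upClosure F S) → ¬ T (upClosure F (∁ S))
upClosure-antipodal F F-intersecting S S∈U ∁S∈U
  with upClosure⁻ F S∈U | upClosure⁻ F ∁S∈U
... | A , A∈F , A⊆S | B , B∈F , B⊆∁S with F-intersecting A∈F B∈F
... | x , x∈A∩B with x∈p∩q⁻ A B x∈A∩B
... | x∈A , x∈B = x∈p⇒x∉∁p (A⊆S x∈A) (B⊆∁S x∈B)

T-not-∧ : ∀ {a} b → ¬ T b → T a → T (not b ∧ a)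
T-not-∧ false _  a = a
T-not-∧ true  ¬b _ = ⊥-elim (¬b _)

intersecting-cross-sperner-bound : (F G : List (Subset n)) → Unique F → Unique G →
  IntersectingCrossSperner F G → 2 * (length F + length G) ≤ 2 ^ n
intersecting-cross-sperner-bound {n} F G F-unique G-unique (F-intersecting , G-intersecting , F⋈G) = begin
  2 * (length F + length G)    ≤⟨ *-monoʳ-≤ 2 (+-mono-≤ |F|≤|U∖V| |G|≤|V∖U|) ⟩
  2 * (count U∖V + count V∖U)  ≤⟨ symmetric-difference-bound (2 ^ n) _ _ _ {{m^n≢0 2 n}}
                                    U-half V-half U-V-kleitman ⟩
  2 ^ n                        ∎
  where
  open ≤-Reasoning
  U V U∩V U∖V V∖U : Subset n → Bool
  U = upClosure F
  V = upClosure G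
  U∩V S = U S ∧ V S
  U∖V S = not (V S) ∧ U S
  V∖U S = not (U S) ∧ V S

  |U|≡ : count U ≡ count U∩V + count U∖V
  |U|≡ = trans (count-partition U V) (cong (_+ count U∖V) (count-cong _ _ (λ S → ∧-comm (V S) (U S))))
  |V|≡ : count V ≡ count U∩V + count V∖U
  |V|≡ = count-partition V U

  U-half : 2 * (count U∩V + count U∖V) ≤ 2 ^ n
  U-half = subst (λ k → 2 * k ≤ 2 ^ n) |U|≡ (count-antipodal U (upClosure-antipodal F F-intersecting))
  V-half : 2 * (count U∩V + count V∖U) ≤ 2 ^ n
  V-half = subst (λ k → 2 * k ≤ 2 ^ n) |V|≡ (count-antipodal V (upClosure-antipodal G G-intersecting))
  U-V-kleitman : (count U∩V + count U∖V) * (count U∩V + count V∖U) ≤ 2 ^ n * count U∩V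
  U-V-kleitman = subst₂ (λ k l → k * l ≤ 2 ^ n * count U∩V) |U|≡ |V|≡
                        (kleitman U V (upClosure-upClosed F) (upClosure-upClosed G))

  |F|≤|U∖V| : length F ≤ count U∖V
  |F|≤|U∖V| = length≤count U∖V F-unique λ {S} S∈F →
    T-not-∧ (V S) (λ S∈V → let B , B∈G , B⊆S = upClosure⁻ G S∈V in proj₂ (F⋈G S∈F B∈G) B⊆S)
                  (upClosure⁺ F S∈F ⊆-refl)
  |G|≤|V∖U| : length G ≤ count V∖U
  |G|≤|V∖U| = length≤count V∖U G-unique λ {S} S∈G →
    T-not-∧ (U S) (λ S∈U → let A , A∈F , A⊆S = upClosure⁻ F S∈U in proj₁ (F⋈G A∈F S∈G) A⊆S)
                  (upClosure⁺ G S∈G ⊆-refl)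

subsets : ∀ n → List (Subset n)
subsets zero    = [] ∷ []
subsets (suc n) = map (outside ∷_) (subsets n) ++ map (inside ∷_) (subsets n)

length-subsets : ∀ n → length (subsets n) ≡ 2 ^ n
length-subsets zero    = refl
length-subsets (suc n) = begin
  length (map (outside ∷_) (subsets n) ++ map (inside ∷_) (subsets n))
    ≡⟨ length-++ (map (outside ∷_) (subsets n)) ⟩
  length (map (outside ∷_) (subsets n)) + length (map (inside ∷_) (subsets n))
    ≡⟨ cong₂ _+_ (length-map (outside ∷_) (subsets n)) (length-map (inside ∷_) (subsets n)) ⟩
  length (subsets n) + length (subsets n)
    ≡⟨ cong₂ _+_ (length-subsets n) (length-subsets n) ⟩
  2 ^ n + 2 ^ n
    ≡⟨ cong (2 ^ n +_) (+-identityʳ (2 ^ n)) ⟨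
  2 ^ suc n ∎
  where open ≡-Reasoning

∷-injectiveʳ : ∀ s {S S′ : Subset n} → s ∷ S ≡ s ∷ S′ → S ≡ S′
∷-injectiveʳ s refl = refl

subsets-unique : ∀ n → Unique (subsets n)
subsets-unique zero    = All.[] ∷ []
subsets-unique (suc n) =
  Unique.++⁺ (Unique.map⁺ (∷-injectiveʳ outside) (subsets-unique n))
             (Unique.map⁺ (∷-injectiveʳ inside) (subsets-unique n))
             disjoint
  where
  disjoint : ∀ {S} → ¬ (S ∈ map (outside ∷_) (subsets n) × S ∈ map (inside ∷_) (subsets n))
  disjoint (S∈₀ , S∈₁) with ∈-map⁻ (outside ∷_) S∈₀ | ∈-map⁻ (inside ∷_) S∈₁
  ... | _ , _ , refl | _ , _ , ()

star : ∀ n → List (Subset (suc n))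
star n = map (inside ∷_) (subsets n)

length-star : ∀ n → length (star n) ≡ 2 ^ n
length-star n = trans (length-map (inside ∷_) (subsets n)) (length-subsets n)

star-unique : ∀ n → Unique (star n)
star-unique n = Unique.map⁺ (∷-injectiveʳ inside) (subsets-unique n)

star-intersecting : ∀ n → Intersecting (star n)
star-intersecting n A∈ B∈ with ∈-map⁻ (inside ∷_) A∈ | ∈-map⁻ (inside ∷_) B∈
... | _ , _ , refl | _ , _ , refl = zero , Vec.here

theorem12 : (n : ℕ) → n ≥ 1
    → ((F G : List (Subset n)) → Unique F → Unique G → IntersectingCrossSperner F G
    → length F + length G ≤ 2 ^ (n ∸ 1))
    × (Σ[ F ∈ List (Subset n) ] Σ[ G ∈ List (Subset n) ]
    (Unique F × Unique G × IntersectingCrossSperner F G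
    × length F + length G ≡ 2 ^ (n ∸ 1)))
theorem12 (suc n) _ =
  upper-bound ,
  (star n , [] , star-unique n , [] , (star-intersecting n , (λ ()) , (λ _ ())) ,
   trans (+-identityʳ (length (star n))) (length-star n))
  where
  upper-bound : (F G : List (Subset (suc n))) → Unique F → Unique G → IntersectingCrossSperner F G →
    length F + length G ≤ 2 ^ n
  upper-bound F G F-unique G-unique F⋈G =
    *-cancelˡ-≤ 2 (intersecting-cross-sperner-bound F G F-unique G-unique F⋈G)
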